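{- Let $0\le j<k$ be integers, $a_1,\ldots,a_j\in[n-1]$, $a_{j+1},\ldots,a_k\in[n]$, and $c_{j+1},\ldots,c_k\in\mathbb{Z}_r$. If $a_k\notin\mathrm{Ess}(X_{a_1}\cdots X_{a_j}Y_{a_{j+1},c_{j+1}}\cdots Y_{a_{k-1},c_{k-1}})$, then \[\mathbb{E}_{\mathfrak{S}_{n,r}}[X_{a_1}\cdots X_{a_j}Y_{a_{j+1},c_{j+1}}\cdots Y_{a_{k-1},c_{k-1}}Y_{a_k,c_k}]=\frac1r\cdot\mathbb{E}_{\mathfrak{S}_{n,r}}[X_{a_1}\cdots X_{a_j}Y_{a_{j+1},c_{j+1}}\cdots Y_{a_{k-1},c_{k-1}}].\] The same identity holds with $\mathbb{E}_{\mathfrak{S}_{n,r}}$ replaced by $\mathbb{E}_{C_{\boldsymbol{\lambda}}}$ for any conjugacy class $C_{\boldsymbol{\lambda}}$ of $\mathfrak{S}_{n,r}$ without cycles of lengths $1,2,\ldots,j+k$.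
   Context: $\mathfrak{S}_{n,r}$ is the set of pairs $(\omega,\tau)$, $\omega\in\mathfrak{S}_n$, $\tau:[n]\to\mathbb{Z}_r$ (colors $0,\ldots,r-1$), with product $(\omega_1,\tau_1)(\omega_2,\tau_2)=(\omega_1\omega_2,\tau_1\circ\omega_2+\tau_2)$. Order symbols $i^c$ by $1^0<\cdots<n^0<1^1<\cdots<n^1<\cdots<1^{r-1}<\cdots<n^{r-1}$. An index $i\in[n]$ is a descent of $(\omega,\tau)$ if $\omega(i)^{\tau(i)}>\omega(i+1)^{\tau(i+1)}$, with convention $\omega(n+1)=n+1$, $\tau(n+1)=0$. $X_i$ is the indicator that $i$ is a descent; $Y_{i,c}$ is the indicator that $\tau(i)=c$. The essential set of a product $X_{b_1}\cdots X_{b_p}Y_{d_1,e_1}\cdots Y_{d_q,e_q}$ is $\bigcup_{i=1}^p\{b_i,b_i+1\}\cup\{d_1,\ldots,d_q\}$. For a cycle $(i_1\cdots i_\ell)$ of $\omega$, its length is $\ell$ and color $\sum_h\tau(i_h)\in\mathbb{Z}_r$; the cycle type $\boldsymbol{\lambda}=(\lambda^0,\ldots,\lambda^{r-1})$ has $\lambda^j$ listing lengths of cycles of color $j$; conjugacy classes are the sets $C_{\boldsymbol{\lambda}}$ of elements of a given cycle type; "no cycles of lengths $1,\ldots,m$" means no part of any $\lambda^j$ lies in $\{1,\ldots,m\}$. Expectations are with respect to uniform distributions. -}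

module Defs where

open import Data.Bool using (Bool; true; false; _∧_; _∨_; not; if_then_else_)
open import Data.Nat using (ℕ; zero; suc; _+_; _∸_; _≤_; _<ᵇ_; _≡ᵇ_; NonZero)
open import Data.Nat.DivMod using (_%_; _/_)
open import Data.Fin using (Fin; toℕ)
import Data.Fin as F
open import Data.Integer using (+_)
open import Data.Rational using (ℚ; 0ℚ)
import Data.Rational as Q
open import Data.List using (List; []; _∷_; map; concatMap; allFin; upTo; foldr; length)
open import Data.Bool.ListAction using (and)
open import Data.Vec using (Vec; []; _∷_; lookup)
open import Data.Vec.Relation.Unary.Any using (Any)
open import Data.Maybe using (Maybe; just; nothing; maybe)
open import Data.Product using (_×_; _,_; proj₁; proj₂)
open import Data.Sum using (_⊎_)
open import Relation.Binary.PropositionalEquality using (_≡_)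
open import Relation.Nullary.Decidable using (isYes)

-- Elements of S_{n,r}: (ω, τ) with ω in one-line notation
-- (0-based: ω(i+1) = 1 + toℕ (lookup w i)) and τ(i+1) = lookup t i.
-- A pair is in S_{n,r} iff w is injective (a permutation).

Elt : ℕ → ℕ → Set
Elt n r = Vec (Fin n) n × Vec (Fin r) n

_==F_ : ∀ {n} → Fin n → Fin n → Bool
x ==F y = isYes (x F.≟ y)

isPerm : ∀ {n} → Vec (Fin n) n → Bool
isPerm {n} w = and (map (λ i → and (map (λ j →
  not (lookup w i ==F lookup w j) ∨ (i ==F j)) (allFin n))) (allFin n))

allVecs : (k m : ℕ) → List (Vec (Fin k) m)
allVecs k zero = [] ∷ []
allVecs k (suc m) = concatMap (λ x → map (x ∷_) (allVecs k m)) (allFin k)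

filterB : ∀ {A : Set} → (A → Bool) → List A → List A
filterB p [] = []
filterB p (x ∷ xs) = if p x then x ∷ filterB p xs else filterB p xs

countB : ∀ {A : Set} → (A → Bool) → List A → ℕ
countB p xs = length (filterB p xs)

group : (n r : ℕ) → List (Elt n r)
group n r = concatMap (λ w → map (λ t → (w , t)) (allVecs r n))
                      (filterB isPerm (allVecs n n))

-- Uniform expectation of a 0/1 random variable over a finite list
-- (taken to be 0 on an empty list; never used for empty lists here).

ratio : ℕ → ℕ → ℚ
ratio a zero = 0ℚ
ratio a (suc m) = (+ a) Q./ (suc m)

E : ∀ {A : Set} → List A → (A → Bool) → ℚ
E S f = ratio (countB f S) (length S)

-- Descents, with 1-based positions; position n+1 has ω = n+1, τ = 0.

lookupℕ : ∀ {A : Set} {m} → Vec A m → ℕ → Maybe A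
lookupℕ [] _ = nothing
lookupℕ (x ∷ xs) zero = just x
lookupℕ (x ∷ xs) (suc i) = lookupℕ xs i

valAt : ∀ {n r} → Elt n r → ℕ → ℕ
valAt {n} (w , t) i = maybe (λ f → suc (toℕ f)) (suc n) (lookupℕ w (i ∸ 1))

colAt : ∀ {n r} → Elt n r → ℕ → ℕ
colAt (w , t) i = maybe toℕ 0 (lookupℕ t (i ∸ 1))

symGt : ℕ × ℕ → ℕ × ℕ → Bool
symGt (c₁ , v₁) (c₂ , v₂) = (c₂ <ᵇ c₁) ∨ ((c₁ ≡ᵇ c₂) ∧ (v₂ <ᵇ v₁))

X : ∀ {n r} → ℕ → Elt n r → Bool
X i g = symGt (colAt g i , valAt g i) (colAt g (suc i) , valAt g (suc i))

Y : ∀ {n r} → ℕ → Fin r → Elt n r → Bool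
Y i c g = colAt g i ≡ᵇ toℕ c

allV : ∀ {A : Set} {m} → (A → Bool) → Vec A m → Bool
allV p [] = true
allV p (x ∷ xs) = p x ∧ allV p xs

prodXY : ∀ {n r p q} → Vec ℕ p → Vec (ℕ × Fin r) q → Elt n r → Bool
prodXY bs ds g = allV (λ b → X b g) bs ∧ allV (λ de → Y (proj₁ de) (proj₂ de) g) ds

InEss : ∀ {r p q} → ℕ → Vec ℕ p → Vec (ℕ × Fin r) q → Set
InEss a bs ds = Any (λ b → a ≡ b ⊎ a ≡ suc b) bs ⊎ Any (λ de → a ≡ proj₁ de) ds

iter : ∀ {n} → Vec (Fin n) n → ℕ → Fin n → Fin n
iter w zero i = i
iter w (suc m) i = lookup w (iter w m i)

firstIn : List ℕ → (ℕ → Bool) → ℕ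
firstIn [] p = 0
firstIn (m ∷ ms) p = if p m then m else firstIn ms p

cycleLen : ∀ {n} → Vec (Fin n) n → Fin n → ℕ
cycleLen {n} w i = firstIn (map suc (upTo n)) (λ m → iter w m i ==F i)

cycleCol : ∀ {n r} .{{_ : NonZero r}} → Elt n r → Fin n → ℕ
cycleCol {r = r} (w , t) i =
  foldr _+_ 0 (map (λ h → toℕ (lookup t (iter w h i))) (upTo (cycleLen w i))) % r

-- number of cycles of length ℓ and colour c (ℓ ≥ 1): number of points lying
-- on such cycles, divided by ℓ
numCycles : ∀ {n r} .{{_ : NonZero r}} → Elt n r → ℕ → Fin r → ℕ
numCycles {n} g zero c = 0
numCycles {n} g (suc l) c =
  countB (λ i → (cycleLen (proj₁ g) i ≡ᵇ suc l) ∧ (cycleCol g i ≡ᵇ toℕ c)) (allFin n)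
    / suc l

-- same cycle type (all cycle lengths are ≤ n)
sameType : ∀ {n r} .{{_ : NonZero r}} → Elt n r → Elt n r → Bool
sameType {n} {r} g h =
  and (map (λ l → and (map (λ c → numCycles g l c ≡ᵇ numCycles h l c) (allFin r)))
           (map suc (upTo n)))

classOf : ∀ {n r} .{{_ : NonZero r}} → Elt n r → List (Elt n r)
classOf {n} {r} g₀ = filterB (λ g → sameType g g₀) (group n r)

_⊗_ : ∀ {A : Set} → (A → Bool) → (A → Bool) → A → Bool
(f ⊗ g) x = f x ∧ g x

-- Fix the permutation ω and count colourings τ. If a property Q of colourings is invariant
-- under adding (mod r) a fixed offset D with D(a) = 1, then translation by D cycles the
-- Q-colourings through the r values of τ(a), so each value is taken by exactly 1/r of them.
-- The product of the X's and Y's reads colours only on its essential set, so over the whole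
-- group D = δ_a works. Within a conjugacy class the cycle colours must be kept as well:
-- without cycles of length ≤ j + k, the cycle of ω through a has more than j + k points,
-- so by pigeonhole one of them, y, lies outside the essential set, and D = δ_a - δ_y works
-- (the +1 and -1 fall on the same cycle). If that cycle is short, ω contributes to neither side.

module Submission where

open import Defs

-- A separate module keeps ℕ's _*_ and _/_ out of scope of the statement, which uses ℚ's.
module Counting where

  open import Data.Bool using (Bool; true; false; _∧_; _∨_; not; if_then_else_)
  open import Data.Bool.ListAction using (and)
  open import Data.Bool.Properties using (∧-assoc; T-≡)
  open import Data.Fin as F using (Fin; toℕ; fromℕ<)
  open import Data.Fin.Properties using (toℕ-injective; toℕ-fromℕ<; toℕ<n; injective⇒≤; any?; pigeonhole)
  open import Data.List as L using (List; []; _∷_; _++_; map; concatMap; length; applyUpTo; upTo; allFin; tabulate)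
  open import Data.List.Membership.Propositional using (_∈_; _∉_)
  open import Data.List.Membership.Propositional.Properties using (∈-allFin; ∈-map⁺; ∈-upTo⁺)
  open import Data.List.Properties using (map-cong; map-tabulate; map-upTo; applyUpTo-∷ʳ)
  open import Data.List.Relation.Unary.Any as Any using (here; there)
  open import Data.List.Relation.Unary.Any.Properties using (lookup-index)
  open import Data.List.Relation.Unary.All as Allₗ using ()
  open import Data.List.Relation.Unary.All.Properties using (all⁺)
  open import Data.Maybe using (just; maybe)
  open import Data.Nat using (ℕ; zero; suc; pred; _+_; _*_; _∸_; _≤_; _<_; _≡ᵇ_; NonZero; z≤n; s≤s; z<s; s<s; s≤s⁻¹)
  open import Data.Nat.DivMod
  open import Data.Nat.ListAction using (sum)
  open import Data.Nat.ListAction.Properties using (sum-++)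
  open import Data.Nat.Properties
  open import Algebra.Properties.CommutativeSemigroup +-commutativeSemigroup using (interchange)
  open import Data.List.Membership.DecPropositional _≟_ using (_∈?_)
  open import Data.Product using (_×_; _,_; proj₁; proj₂; ∃)
  open import Data.Sum using (_⊎_; inj₁; inj₂)
  open import Data.Vec as V using (Vec; []; _∷_; lookup)
  open import Data.Vec.Properties using (lookup∘tabulate)
  open import Data.Vec.Relation.Unary.All using (All; []; _∷_)
  open import Data.Vec.Relation.Unary.Any using (Any; here; there)
  open import Function using (_∘_; mk⇔; Equivalence)
  open import Function.Definitions using (Injective)
  open import Relation.Binary.Definitions using (tri<; tri≈; tri>)
  open import Relation.Binary.PropositionalEquality
  open import Relation.Nullary using (¬_; yes; no; contradiction)
  open import Relation.Nullary.Decidable using (isYes; does; isYes≗does; dec-true; dec-false; does-⇔; toWitness; ¬?; decidable-stable)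

  open ≡-Reasoning

  -- Counting and finite sums

  indicator : Bool → ℕ
  indicator b = if b then 1 else 0

  module _ {A : Set} where

    countB-∷ : (p : A → Bool) (x : A) (xs : List A) →
               countB p (x ∷ xs) ≡ indicator (p x) + countB p xs
    countB-∷ p x xs with p x
    ... | true  = refl
    ... | false = refl

    countB-++ : (p : A → Bool) (xs ys : List A) →
                countB p (xs ++ ys) ≡ countB p xs + countB p ys
    countB-++ p []       ys = refl
    countB-++ p (x ∷ xs) ys with p x
    ... | true  = cong suc (countB-++ p xs ys)
    ... | false = countB-++ p xs ys

    countB-cong : {p q : A → Bool} → (∀ x → p x ≡ q x) → (xs : List A) → countB p xs ≡ countB q xs
    countB-cong p≗q []                = refl
    countB-cong {p} {q} p≗q (x ∷ xs) = begin
      countB p (x ∷ xs)             ≡⟨ countB-∷ p x xs ⟩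
      indicator (p x) + countB p xs ≡⟨ cong₂ _+_ (cong indicator (p≗q x)) (countB-cong p≗q xs) ⟩
      indicator (q x) + countB q xs ≡⟨ countB-∷ q x xs ⟨
      countB q (x ∷ xs)             ∎

    countB-none : (p : A → Bool) → (∀ x → p x ≡ false) → (xs : List A) → countB p xs ≡ 0
    countB-none p ¬p []       = refl
    countB-none p ¬p (x ∷ xs) rewrite ¬p x = countB-none p ¬p xs

    countB-filterB : (p q : A → Bool) (xs : List A) →
                     countB p (filterB q xs) ≡ countB (λ x → q x ∧ p x) xs
    countB-filterB p q []       = refl
    countB-filterB p q (x ∷ xs) with q x
    ... | false = countB-filterB p q xs
    ... | true with p x
    ...   | true  = cong suc (countB-filterB p q xs)
    ...   | false = countB-filterB p q xs

    ∈-filterB : (p : A → Bool) {x : A} {xs : List A} → x ∈ xs → p x ≡ true → x ∈ filterB p xs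
    ∈-filterB p {xs = y ∷ xs} x∈ px with p y in py
    ∈-filterB p (here refl) px | true  = here refl
    ∈-filterB p (there x∈)  px | true  = there (∈-filterB p x∈ px)
    ∈-filterB p (here refl) px | false = contradiction (trans (sym px) py) λ ()
    ∈-filterB p (there x∈)  px | false = ∈-filterB p x∈ px

    *-sum-filterB : (p : A → Bool) (k : ℕ) {f g : A → ℕ} → (∀ x → p x ≡ true → k * f x ≡ g x) →
                    (xs : List A) → k * sum (map f (filterB p xs)) ≡ sum (map g (filterB p xs))
    *-sum-filterB p k k*f≡g []       = *-zeroʳ k
    *-sum-filterB p k {f} k*f≡g (x ∷ xs) with p x in px
    ... | true  = trans (*-distribˡ-+ k (f x) _) (cong₂ _+_ (k*f≡g x px) (*-sum-filterB p k k*f≡g xs))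
    ... | false = *-sum-filterB p k k*f≡g xs

    and-map-∈ : (f : A → Bool) {xs : List A} {x : A} → and (map f xs) ≡ true →
                x ∈ xs → f x ≡ true
    and-map-∈ f {xs} all-f x∈ =
      Equivalence.to T-≡ (Allₗ.lookup (all⁺ f xs (Equivalence.from T-≡ all-f)) x∈)

    injective⇒≤length : ∀ {m} {xs : List A} (f : Fin m → A) → Injective _≡_ _≡_ f →
                        (∀ h → f h ∈ xs) → m ≤ length xs
    injective⇒≤length {xs = xs} f f-inj f∈xs = injective⇒≤ λ {h₁} {h₂} same-index → f-inj (begin
      f h₁                             ≡⟨ lookup-index (f∈xs h₁) ⟩
      L.lookup xs (Any.index (f∈xs h₁)) ≡⟨ cong (L.lookup xs) same-index ⟩
      L.lookup xs (Any.index (f∈xs h₂)) ≡⟨ lookup-index (f∈xs h₂) ⟨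
      f h₂                             ∎)

  module _ {A B : Set} where

    countB-map : (p : B → Bool) (f : A → B) (xs : List A) → countB p (map f xs) ≡ countB (p ∘ f) xs
    countB-map p f []       = refl
    countB-map p f (x ∷ xs) with p (f x)
    ... | true  = cong suc (countB-map p f xs)
    ... | false = countB-map p f xs

    countB-concatMap : (p : B → Bool) (f : A → List B) (xs : List A) →
                       countB p (concatMap f xs) ≡ sum (map (countB p ∘ f) xs)
    countB-concatMap p f []       = refl
    countB-concatMap p f (x ∷ xs) =
      trans (countB-++ p (f x) (concatMap f xs)) (cong (countB p (f x) +_) (countB-concatMap p f xs))

  ≡ᵇ-refl : ∀ m → (m ≡ᵇ m) ≡ true
  ≡ᵇ-refl m = dec-true (m ≟ m) refl

  module _ {k : ℕ} where

    ==F-refl : (x : Fin k) → (x ==F x) ≡ true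
    ==F-refl x = trans (isYes≗does (x F.≟ x)) (dec-true (x F.≟ x) refl)

    ==F-≢ : {x y : Fin k} → x ≢ y → (x ==F y) ≡ false
    ==F-≢ {x} {y} x≢y = trans (isYes≗does (x F.≟ y)) (dec-false (x F.≟ y) x≢y)

    ==F⇒≡ : {x y : Fin k} → (x ==F y) ≡ true → x ≡ y
    ==F⇒≡ {x} {y} eq = toWitness {a? = x F.≟ y} (Equivalence.from T-≡ eq)

    ==F-injective : ∀ {m} {f : Fin k → Fin m} → Injective _≡_ _≡_ f →
                    ∀ x y → (f x ==F f y) ≡ (x ==F y)
    ==F-injective {f = f} f-inj x y = begin
      isYes (f x F.≟ f y) ≡⟨ isYes≗does (f x F.≟ f y) ⟩
      does (f x F.≟ f y)  ≡⟨ does-⇔ (mk⇔ f-inj (cong f)) (f x F.≟ f y) (x F.≟ y) ⟩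
      does (x F.≟ y)      ≡⟨ isYes≗does (x F.≟ y) ⟨
      isYes (x F.≟ y)     ∎

  ∑< : ℕ → (ℕ → ℕ) → ℕ
  ∑< L f = sum (applyUpTo f L)

  syntax ∑< L (λ h → e) = ∑[ h < L ] e

  ∑-cong : ∀ L {f g : ℕ → ℕ} → (∀ h → h < L → f h ≡ g h) → ∑< L f ≡ ∑< L g
  ∑-cong zero    f≗g = refl
  ∑-cong (suc L) f≗g = cong₂ _+_ (f≗g 0 z<s) (∑-cong L λ h h<L → f≗g (suc h) (s<s h<L))

  ∑-+ : ∀ L (f g : ℕ → ℕ) → ∑[ h < L ] (f h + g h) ≡ ∑< L f + ∑< L g
  ∑-+ zero    f g = refl
  ∑-+ (suc L) f g =
    trans (cong (f 0 + g 0 +_) (∑-+ L (f ∘ suc) (g ∘ suc))) (interchange (f 0) (g 0) _ _)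

  ∑-* : ∀ L k (f : ℕ → ℕ) → ∑[ h < L ] (k * f h) ≡ k * ∑< L f
  ∑-* zero    k f = sym (*-zeroʳ k)
  ∑-* (suc L) k f = trans (cong (k * f 0 +_) (∑-* L k (f ∘ suc))) (sym (*-distribˡ-+ k (f 0) _))

  ∑-const : ∀ L k → ∑[ h < L ] k ≡ L * k
  ∑-const zero    k = refl
  ∑-const (suc L) k = cong (k +_) (∑-const L k)

  ∑-zero : ∀ L → ∑[ h < L ] 0 ≡ 0
  ∑-zero L = trans (∑-const L 0) (*-zeroʳ L)

  ∑-suc : ∀ L (f : ℕ → ℕ) → ∑< (suc L) f ≡ ∑< L f + f L
  ∑-suc L f = begin
    sum (applyUpTo f (suc L))        ≡⟨ cong sum (applyUpTo-∷ʳ f L) ⟨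
    sum (applyUpTo f L ++ f L ∷ [])  ≡⟨ sum-++ (applyUpTo f L) (f L ∷ []) ⟩
    ∑< L f + (f L + 0)               ≡⟨ cong (∑< L f +_) (+-identityʳ (f L)) ⟩
    ∑< L f + f L                     ∎

  ∑-indicator-≡ᵇ : ∀ {L v} → v < L → ∑[ k < L ] indicator (v ≡ᵇ k) ≡ 1
  ∑-indicator-≡ᵇ {suc L} {zero}  _         = cong suc (∑-zero L)
  ∑-indicator-≡ᵇ {suc L} {suc v} (s<s v<L) = ∑-indicator-≡ᵇ v<L

  ∑-countB-fibres : ∀ {A : Set} L (p : A → Bool) (v : A → ℕ) → (∀ x → v x < L) → (xs : List A) →
                    ∑[ k < L ] countB (λ x → p x ∧ (v x ≡ᵇ k)) xs ≡ countB p xs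
  ∑-countB-fibres L p v v<L []       = ∑-zero L
  ∑-countB-fibres L p v v<L (x ∷ xs) = begin
    ∑[ k < L ] countB (p-at k) (x ∷ xs)
      ≡⟨ ∑-cong L (λ k _ → countB-∷ (p-at k) x xs) ⟩
    ∑[ k < L ] (indicator (p-at k x) + countB (p-at k) xs)
      ≡⟨ ∑-+ L (λ k → indicator (p-at k x)) (λ k → countB (p-at k) xs) ⟩
    ∑[ k < L ] indicator (p-at k x) + ∑[ k < L ] countB (p-at k) xs
      ≡⟨ cong₂ _+_ x-in-one-fibre (∑-countB-fibres L p v v<L xs) ⟩
    indicator (p x) + countB p xs
      ≡⟨ countB-∷ p x xs ⟨
    countB p (x ∷ xs) ∎
    where
    p-at : ℕ → _ → Bool
    p-at k y = p y ∧ (v y ≡ᵇ k)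
    x-in-one-fibre : ∑[ k < L ] indicator (p-at k x) ≡ indicator (p x)
    x-in-one-fibre with p x
    ... | true  = ∑-indicator-≡ᵇ (v<L x)
    ... | false = ∑-zero L

  ∑-rotate : ∀ L (f : ℕ → ℕ) → (∀ h → f (h + L) ≡ f h) → ∀ s → ∑[ h < L ] f (h + s) ≡ ∑< L f
  ∑-rotate L f periodic zero    = ∑-cong L λ h _ → cong f (+-identityʳ h)
  ∑-rotate L f periodic (suc s) = begin
    ∑[ h < L ] f (h + suc s) ≡⟨ ∑-cong L (λ h _ → cong f (+-suc h s)) ⟩
    ∑< L (g ∘ suc)           ≡⟨ rotate-by-one ⟩
    ∑< L g                   ≡⟨ ∑-rotate L f periodic s ⟩
    ∑< L f                   ∎
    where
    g : ℕ → ℕ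
    g h = f (h + s)
    rotate-by-one : ∑< L (g ∘ suc) ≡ ∑< L g
    rotate-by-one = +-cancelˡ-≡ (g 0) _ _ (begin
      ∑< (suc L) g       ≡⟨ ∑-suc L g ⟩
      ∑< L g + g L       ≡⟨ cong (λ z → ∑< L g + f z) (+-comm L s) ⟩
      ∑< L g + f (s + L) ≡⟨ cong (∑< L g +_) (periodic s) ⟩
      ∑< L g + g 0       ≡⟨ +-comm (∑< L g) (g 0) ⟩
      g 0 + ∑< L g       ∎)

  ∑-% : ∀ L (f : ℕ → ℕ) d .{{_ : NonZero d}} → (∑[ h < L ] (f h % d)) % d ≡ ∑< L f % d
  ∑-% zero    f d = refl
  ∑-% (suc L) f d = begin
    (f 0 % d + ∑[ h < L ] (f (suc h) % d)) % d         ≡⟨ %-distribˡ-+ (f 0 % d) _ d ⟩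
    (f 0 % d % d + ∑[ h < L ] (f (suc h) % d) % d) % d ≡⟨ cong₂ (λ x y → (x + y) % d) (m%n%n≡m%n (f 0) d) (∑-% L (f ∘ suc) d) ⟩
    (f 0 % d + ∑< L (f ∘ suc) % d) % d                 ≡⟨ %-distribˡ-+ (f 0) _ d ⟨
    (f 0 + ∑< L (f ∘ suc)) % d                         ∎

  [m%d+n]%d≡[m+n]%d : ∀ m n d .{{_ : NonZero d}} → (m % d + n) % d ≡ (m + n) % d
  [m%d+n]%d≡[m+n]%d m n d = begin
    (m % d + n) % d           ≡⟨ %-distribˡ-+ (m % d) n d ⟩
    (m % d % d + n % d) % d   ≡⟨ cong (λ x → (x + n % d) % d) (m%n%n≡m%n m d) ⟩
    (m % d + n % d) % d       ≡⟨ %-distribˡ-+ m n d ⟨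
    (m + n) % d               ∎

  +1-%-injective : ∀ {d} .{{_ : NonZero d}} {x y} → x < d → y < d → (x + 1) % d ≡ (y + 1) % d → x ≡ y
  +1-%-injective {d} {x} {y} x<d y<d eq = begin
    x                          ≡⟨ undo x<d ⟨
    ((x + 1) % d + pred d) % d ≡⟨ cong (λ z → (z + pred d) % d) eq ⟩
    ((y + 1) % d + pred d) % d ≡⟨ undo y<d ⟩
    y                          ∎
    where
    undo : ∀ {z} → z < d → ((z + 1) % d + pred d) % d ≡ z
    undo {z} z<d = begin
      ((z + 1) % d + pred d) % d ≡⟨ [m%d+n]%d≡[m+n]%d (z + 1) (pred d) d ⟩
      (z + 1 + pred d) % d       ≡⟨ cong (_% d) (trans (+-assoc z 1 (pred d)) (cong (z +_) (suc-pred d))) ⟩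
      (z + d) % d                ≡⟨ [m+n]%n≡m%n z d ⟩
      z % d                      ≡⟨ m<n⇒m%n≡m z<d ⟩
      z                          ∎

  toℕ-mod : ∀ m d .{{_ : NonZero d}} → toℕ (m mod d) ≡ m % d
  toℕ-mod m d = toℕ-fromℕ< (m%n<n m d)

  mod-toℕ : ∀ {d} .{{_ : NonZero d}} (x : Fin d) → toℕ x mod d ≡ x
  mod-toℕ {d} x = toℕ-injective (trans (toℕ-mod (toℕ x) d) (m<n⇒m%n≡m (toℕ<n x)))

  sum-tabulate : ∀ k (f : Fin k → ℕ) (g : ℕ → ℕ) → (∀ i → f i ≡ g (toℕ i)) → sum (tabulate f) ≡ ∑< k g
  sum-tabulate zero    f g f≗g = refl
  sum-tabulate (suc k) f g f≗g =
    cong₂ _+_ (f≗g F.zero) (sum-tabulate k (f ∘ F.suc) (g ∘ suc) (f≗g ∘ F.suc))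

  -- Translating colourings

  module _ {r : ℕ} .{{_ : NonZero r}} where

    sum-allFin : (G : Fin r → ℕ) → sum (map G (allFin r)) ≡ ∑[ j < r ] G (j mod r)
    sum-allFin G = trans (cong sum (map-tabulate (λ x → x) G))
                         (sum-tabulate r G (λ j → G (j mod r)) (λ i → cong G (sym (mod-toℕ i))))

    sum-allFin-rotate : (G : Fin r → ℕ) (d : ℕ) →
                        sum (map (λ x → G ((toℕ x + d) mod r)) (allFin r)) ≡ sum (map G (allFin r))
    sum-allFin-rotate G d = begin
      sum (map (λ x → G ((toℕ x + d) mod r)) (allFin r)) ≡⟨ sum-allFin _ ⟩
      ∑[ j < r ] G ((toℕ (j mod r) + d) mod r)          ≡⟨ ∑-cong r (λ j _ → cong G (reduce j)) ⟩
      ∑[ j < r ] G ((j + d) mod r)                       ≡⟨ ∑-rotate r (λ j → G (j mod r)) periodic d ⟩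
      ∑[ j < r ] G (j mod r)                             ≡⟨ sum-allFin G ⟨
      sum (map G (allFin r))                             ∎
      where
      reduce : ∀ j → (toℕ (j mod r) + d) mod r ≡ (j + d) mod r
      reduce j = toℕ-injective (begin
        toℕ ((toℕ (j mod r) + d) mod r) ≡⟨ toℕ-mod _ r ⟩
        (toℕ (j mod r) + d) % r         ≡⟨ cong (λ z → (z + d) % r) (toℕ-mod j r) ⟩
        (j % r + d) % r                 ≡⟨ [m%d+n]%d≡[m+n]%d j d r ⟩
        (j + d) % r                     ≡⟨ toℕ-mod _ r ⟨
        toℕ ((j + d) mod r)             ∎)
      periodic : ∀ j → G ((j + r) mod r) ≡ G (j mod r)
      periodic j = cong G (toℕ-injective (trans (toℕ-mod (j + r) r)
                     (trans ([m+n]%n≡m%n j r) (sym (toℕ-mod j r)))))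

    shift : ∀ {n} → (Fin n → ℕ) → Vec (Fin r) n → Vec (Fin r) n
    shift D t = V.tabulate λ x → (toℕ (lookup t x) + D x) mod r

    toℕ-lookup-shift : ∀ {n} (D : Fin n → ℕ) (t : Vec (Fin r) n) (x : Fin n) →
                       toℕ (lookup (shift D t) x) ≡ (toℕ (lookup t x) + D x) % r
    toℕ-lookup-shift D t x = trans (cong toℕ (lookup∘tabulate _ x)) (toℕ-mod _ r)

    lookup-shift-0 : ∀ {n} (D : Fin n → ℕ) (t : Vec (Fin r) n) (x : Fin n) → D x ≡ 0 →
                     lookup (shift D t) x ≡ lookup t x
    lookup-shift-0 D t x D[x]≡0 = toℕ-injective (begin
      toℕ (lookup (shift D t) x)     ≡⟨ toℕ-lookup-shift D t x ⟩
      (toℕ (lookup t x) + D x) % r   ≡⟨ cong (λ d → (toℕ (lookup t x) + d) % r) D[x]≡0 ⟩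
      (toℕ (lookup t x) + 0) % r     ≡⟨ cong (_% r) (+-identityʳ _) ⟩
      toℕ (lookup t x) % r           ≡⟨ m<n⇒m%n≡m (toℕ<n _) ⟩
      toℕ (lookup t x)               ∎)

    countB-shift : ∀ n (D : Fin n → ℕ) (f : Vec (Fin r) n → Bool) →
                   countB (f ∘ shift D) (allVecs r n) ≡ countB f (allVecs r n)
    countB-shift zero    D f = refl
    countB-shift (suc n) D f = begin
      countB (f ∘ shift D) (allVecs r (suc n))
        ≡⟨ countB-concatMap _ _ (allFin r) ⟩
      sum (map (λ x → countB (f ∘ shift D) (map (x ∷_) (allVecs r n))) (allFin r))
        ≡⟨ cong sum (map-cong (λ x → trans (countB-map _ (x ∷_) (allVecs r n))
                                           (countB-shift n (D ∘ F.suc) (f ∘ (_ ∷_)))) (allFin r)) ⟩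
      sum (map (λ x → G ((toℕ x + D F.zero) mod r)) (allFin r))
        ≡⟨ sum-allFin-rotate G (D F.zero) ⟩
      sum (map G (allFin r))
        ≡⟨ cong sum (map-cong (λ x → countB-map f (x ∷_) (allVecs r n)) (allFin r)) ⟨
      sum (map (λ x → countB f (map (x ∷_) (allVecs r n))) (allFin r))
        ≡⟨ countB-concatMap _ _ (allFin r) ⟨
      countB f (allVecs r (suc n)) ∎
      where
      G : Fin r → ℕ
      G y = countB (f ∘ (y ∷_)) (allVecs r n)

    countB-fibre : ∀ {n} (Q : Vec (Fin r) n → Bool) (x : Fin n) (D : Fin n → ℕ) → D x ≡ 1 →
                   (∀ t → Q (shift D t) ≡ Q t) → (c : Fin r) →
                   r * countB (λ t → Q t ∧ (toℕ (lookup t x) ≡ᵇ toℕ c)) (allVecs r n) ≡ countB Q (allVecs r n)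
    countB-fibre {n} Q x D D[x]≡1 Q-shift c = begin
      r * fibre (toℕ c)      ≡⟨ cong (r *_) (fibre-const (toℕ c) (toℕ<n c)) ⟩
      r * fibre 0            ≡⟨ ∑-const r (fibre 0) ⟨
      ∑[ k < r ] fibre 0     ≡⟨ ∑-cong r (λ k k<r → sym (fibre-const k k<r)) ⟩
      ∑< r fibre             ≡⟨ ∑-countB-fibres r Q (λ t → toℕ (lookup t x)) (λ t → toℕ<n _) (allVecs r n) ⟩
      countB Q (allVecs r n) ∎
      where
      fibre : ℕ → ℕ
      fibre k = countB (λ t → Q t ∧ (toℕ (lookup t x) ≡ᵇ k)) (allVecs r n)

      fibre-+1 : ∀ k → k < r → fibre ((k + 1) % r) ≡ fibre k
      fibre-+1 k k<r = trans (sym (countB-shift n D _)) (countB-cong moved (allVecs r n))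
        where
        moved : ∀ t → (Q (shift D t) ∧ (toℕ (lookup (shift D t) x) ≡ᵇ (k + 1) % r))
                      ≡ (Q t ∧ (toℕ (lookup t x) ≡ᵇ k))
        moved t = cong₂ _∧_ (Q-shift t) (begin
          (toℕ (lookup (shift D t) x) ≡ᵇ (k + 1) % r)
            ≡⟨ cong (_≡ᵇ (k + 1) % r) (trans (toℕ-lookup-shift D t x)
                                             (cong (λ d → (toℕ (lookup t x) + d) % r) D[x]≡1)) ⟩
          ((toℕ (lookup t x) + 1) % r ≡ᵇ (k + 1) % r)
            ≡⟨ does-⇔ (mk⇔ (+1-%-injective (toℕ<n _) k<r) (cong (λ z → (z + 1) % r)))
                      (_ ≟ _) (_ ≟ _) ⟩
          (toℕ (lookup t x) ≡ᵇ k) ∎)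

      fibre-const : ∀ k → k < r → fibre k ≡ fibre 0
      fibre-const zero    _    = refl
      fibre-const (suc k) 1+k<r = begin
        fibre (suc k)       ≡⟨ cong fibre (trans (cong (_% r) (+-comm k 1)) (m<n⇒m%n≡m 1+k<r)) ⟨
        fibre ((k + 1) % r) ≡⟨ fibre-+1 k k<r ⟩
        fibre k             ≡⟨ fibre-const k k<r ⟩
        fibre 0             ∎
        where k<r = <-trans (n<1+n k) 1+k<r

  -- The essential set

  lookupℕ-toℕ : ∀ {A : Set} {n} (t : Vec A n) (i : Fin n) → lookupℕ t (toℕ i) ≡ just (lookup t i)
  lookupℕ-toℕ (x ∷ t) F.zero    = refl
  lookupℕ-toℕ (x ∷ t) (F.suc i) = lookupℕ-toℕ t i

  lookupℕ-cong : ∀ {A : Set} {n} (t t′ : Vec A n) k →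
                 (∀ i → toℕ i ≡ k → lookup t′ i ≡ lookup t i) → lookupℕ t′ k ≡ lookupℕ t k
  lookupℕ-cong []      []        k       t′≗t = refl
  lookupℕ-cong (x ∷ t) (x′ ∷ t′) zero    t′≗t = cong just (t′≗t F.zero refl)
  lookupℕ-cong (x ∷ t) (x′ ∷ t′) (suc k) t′≗t = lookupℕ-cong t t′ k λ i eq → t′≗t (F.suc i) (cong suc eq)

  colAt-index : ∀ {n r} (w : Vec (Fin n) n) (t : Vec (Fin r) n) (x : Fin n) →
                colAt (w , t) (suc (toℕ x)) ≡ toℕ (lookup t x)
  colAt-index w t x = cong (maybe toℕ 0) (lookupℕ-toℕ t x)

  colAt-shift : ∀ {n r} .{{_ : NonZero r}} (w : Vec (Fin n) n) (t : Vec (Fin r) n) (D : Fin n → ℕ) k →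
                (∀ i → toℕ i ≡ k → D i ≡ 0) → colAt (w , shift D t) (suc k) ≡ colAt (w , t) (suc k)
  colAt-shift w t D k D≡0 =
    cong (maybe toℕ 0) (lookupℕ-cong t (shift D t) k λ i i≡k → lookup-shift-0 D t i (D≡0 i i≡k))

  prodXY-local : ∀ {n r j q} (bs : Vec ℕ j) (ds : Vec (ℕ × Fin r) q) (w : Vec (Fin n) n) (t t′ : Vec (Fin r) n) →
                 (∀ p → InEss p bs ds → colAt (w , t′) p ≡ colAt (w , t) p) →
                 prodXY bs ds (w , t′) ≡ prodXY bs ds (w , t)
  prodXY-local bs ds w t t′ same = cong₂ _∧_ (Xs-local bs (λ p → same p ∘ inj₁)) (Ys-local ds (λ p → same p ∘ inj₂))
    where
    Xs-local : ∀ {j} (bs : Vec ℕ j) → (∀ p → Any (λ b → p ≡ b ⊎ p ≡ suc b) bs → colAt (w , t′) p ≡ colAt (w , t) p) →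
               allV (λ b → X b (w , t′)) bs ≡ allV (λ b → X b (w , t)) bs
    Xs-local []       same = refl
    Xs-local (b ∷ bs) same = cong₂ _∧_
      (cong₂ (λ u v → symGt (u , valAt (w , t) b) (v , valAt (w , t) (suc b)))
             (same b (here (inj₁ refl))) (same (suc b) (here (inj₂ refl))))
      (Xs-local bs λ p → same p ∘ there)
    Ys-local : ∀ {q} (ds : Vec (ℕ × Fin _) q) → (∀ p → Any (λ d → p ≡ proj₁ d) ds → colAt (w , t′) p ≡ colAt (w , t) p) →
               allV (λ d → Y (proj₁ d) (proj₂ d) (w , t′)) ds ≡ allV (λ d → Y (proj₁ d) (proj₂ d) (w , t)) ds
    Ys-local []       same = refl
    Ys-local (d ∷ ds) same = cong₂ _∧_ (cong (_≡ᵇ toℕ (proj₂ d)) (same (proj₁ d) (here refl))) (Ys-local ds λ p → same p ∘ there)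

  InEss⇒1≤ : ∀ {r j q p} {bs : Vec ℕ j} {ds : Vec (ℕ × Fin r) q} →
             All (1 ≤_) bs → All ((1 ≤_) ∘ proj₁) ds → InEss p bs ds → 1 ≤ p
  InEss⇒1≤ (1≤b ∷ _)   _           (inj₁ (here (inj₁ refl))) = 1≤b
  InEss⇒1≤ (_ ∷ _)     _           (inj₁ (here (inj₂ refl))) = s≤s z≤n
  InEss⇒1≤ (_ ∷ 1≤bs)  1≤ds        (inj₁ (there p∈))         = InEss⇒1≤ 1≤bs 1≤ds (inj₁ p∈)
  InEss⇒1≤ _           (1≤d ∷ _)   (inj₂ (here refl))        = 1≤d
  InEss⇒1≤ {bs = bs} 1≤bs (_ ∷ 1≤ds) (inj₂ (there p∈))      = InEss⇒1≤ {bs = bs} 1≤bs 1≤ds (inj₂ p∈)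

  prodXY-shift : ∀ {n r j q} .{{_ : NonZero r}} (bs : Vec ℕ j) (ds : Vec (ℕ × Fin r) q) →
                 All (1 ≤_) bs → All ((1 ≤_) ∘ proj₁) ds → (D : Fin n → ℕ) →
                 (∀ i → InEss (suc (toℕ i)) bs ds → D i ≡ 0) →
                 ∀ w t → prodXY bs ds (w , shift D t) ≡ prodXY bs ds (w , t)
  prodXY-shift bs ds 1≤bs 1≤ds D D≡0 w t = prodXY-local bs ds w t (shift D t) unshifted
    where
    unshifted : ∀ p → InEss p bs ds → colAt (w , shift D t) p ≡ colAt (w , t) p
    unshifted (suc k) p∈ = colAt-shift w t D k λ { i refl → D≡0 i p∈ }
    unshifted zero    p∈ = contradiction (InEss⇒1≤ 1≤bs 1≤ds p∈) λ ()

  essList : ∀ {r j q} → Vec ℕ j → Vec (ℕ × Fin r) q → List ℕ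
  essList (b ∷ bs) ds       = b ∷ suc b ∷ essList bs ds
  essList []       (d ∷ ds) = proj₁ d ∷ essList [] ds
  essList []       []       = []

  length-essList : ∀ {r j q} (bs : Vec ℕ j) (ds : Vec (ℕ × Fin r) q) → length (essList bs ds) < j + (j + q + 1)
  length-essList []       []       = s≤s z≤n
  length-essList []       (d ∷ ds) = s<s (length-essList [] ds)
  length-essList {j = suc j} {q} (b ∷ bs) ds =
    s<s (subst (suc (length (essList bs ds)) <_) (sym (+-suc j (j + q + 1))) (s<s (length-essList bs ds)))

  InEss⇒∈essList : ∀ {r j q p} (bs : Vec ℕ j) (ds : Vec (ℕ × Fin r) q) → InEss p bs ds → p ∈ essList bs ds
  InEss⇒∈essList (b ∷ bs) ds (inj₁ (here (inj₁ eq))) = here eq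
  InEss⇒∈essList (b ∷ bs) ds (inj₁ (here (inj₂ eq))) = there (here eq)
  InEss⇒∈essList (b ∷ bs) ds (inj₁ (there p∈))       = there (there (InEss⇒∈essList bs ds (inj₁ p∈)))
  InEss⇒∈essList (b ∷ bs) ds (inj₂ p∈)               = there (there (InEss⇒∈essList bs ds (inj₂ p∈)))
  InEss⇒∈essList []       (d ∷ ds) (inj₂ (here eq))   = here eq
  InEss⇒∈essList []       (d ∷ ds) (inj₂ (there p∈))  = there (InEss⇒∈essList [] ds (inj₂ p∈))

  -- Cycles of a permutation

  isPerm⇒injective : ∀ {n} (w : Vec (Fin n) n) → isPerm w ≡ true → Injective _≡_ _≡_ (lookup w)
  isPerm⇒injective {n} w perm {i} {j} wi≡wj = ==F⇒≡ (begin
    (i ==F j)                                   ≡⟨ cong (λ b → not b ∨ (i ==F j)) wi==wj ⟨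
    not (lookup w i ==F lookup w j) ∨ (i ==F j) ≡⟨ and-map-∈ _ (and-map-∈ _ perm (∈-allFin i)) (∈-allFin j) ⟩
    true                                        ∎)
    where
    wi==wj : (lookup w i ==F lookup w j) ≡ true
    wi==wj = trans (cong (lookup w i ==F_) (sym wi≡wj)) (==F-refl (lookup w i))

  firstIn-least : ∀ k (f : ℕ → ℕ) (p : ℕ → Bool) m → m < k → p (f m) ≡ true →
                  ∃ λ j → j ≤ m × firstIn (applyUpTo f k) p ≡ f j × p (f j) ≡ true ×
                          (∀ j′ → j′ < j → p (f j′) ≡ false)
  firstIn-least (suc k) f p zero _ pfm with p (f 0) in pf0
  ... | true  = 0 , z≤n , refl , pf0 , λ _ ()
  ... | false = contradiction pfm λ ()
  firstIn-least (suc k) f p (suc m) (s<s m<k) pfm with p (f 0) in pf0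
  ... | true  = 0 , z≤n , refl , pf0 , λ _ ()
  ... | false with firstIn-least k (f ∘ suc) p m m<k pfm
  ...   | j , j≤m , found , pfj , before = suc j , s≤s j≤m , found , pfj , λ where
            zero     _          → pf0
            (suc j′) (s<s j′<j) → before j′ j′<j

  cycleCol<r : ∀ {n r} .{{_ : NonZero r}} (g : Elt n r) (i : Fin n) → cycleCol g i < r
  cycleCol<r {r = r} g i = m%n<n _ r

  cycleCol-∑ : ∀ {n r} .{{_ : NonZero r}} (w : Vec (Fin n) n) (t : Vec (Fin r) n) (i : Fin n) →
               cycleCol (w , t) i ≡ (∑[ h < cycleLen w i ] toℕ (lookup t (iter w h i))) % r
  cycleCol-∑ {r = r} w t i = cong (λ xs → sum xs % r) (map-upTo _ (cycleLen w i))

  -- +1 at x and pred r ≡ -1 (mod r) at y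
  plusMinus : (r : ℕ) {n : ℕ} → Fin n → Fin n → Fin n → ℕ
  plusMinus r x y z = indicator (z ==F x) + pred r * indicator (z ==F y)

  plusMinus-source : ∀ r {n} {x y : Fin n} → x ≢ y → plusMinus r x y x ≡ 1
  plusMinus-source r {x = x} x≢y = trans
    (cong₂ (λ u v → indicator u + pred r * indicator v) (==F-refl x) (==F-≢ x≢y))
    (cong suc (*-zeroʳ (pred r)))

  plusMinus-elsewhere : ∀ r {n} {x y z : Fin n} → z ≢ x → z ≢ y → plusMinus r x y z ≡ 0
  plusMinus-elsewhere r z≢x z≢y = trans
    (cong₂ (λ u v → indicator u + pred r * indicator v) (==F-≢ z≢x) (==F-≢ z≢y))
    (*-zeroʳ (pred r))

  sameType⇒numCycles≡ : ∀ {n r} .{{_ : NonZero r}} {g g₀ : Elt n r} → sameType g g₀ ≡ true →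
                        ∀ {l} c → l < n → numCycles g (suc l) c ≡ numCycles g₀ (suc l) c
  sameType⇒numCycles≡ same c l<n = ≡ᵇ⇒≡ _ _ (Equivalence.from T-≡
    (and-map-∈ _ (and-map-∈ _ same (∈-map⁺ suc (∈-upTo⁺ l<n))) (∈-allFin c)))

  sameType-cong : ∀ {n r} .{{_ : NonZero r}} (w : Vec (Fin n) n) {t t′ : Vec (Fin r) n} (g₀ : Elt n r) →
                  (∀ i → cycleCol (w , t′) i ≡ cycleCol (w , t) i) → sameType (w , t′) g₀ ≡ sameType (w , t) g₀
  sameType-cong {n} {r} w {t} {t′} g₀ same-colours =
    cong and (map-cong (λ l → cong and (map-cong (λ c → cong (_≡ᵇ numCycles g₀ l c) (same-count l c)) (allFin r)))
                       (map suc (upTo n)))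
    where
    same-count : ∀ l c → numCycles (w , t′) l c ≡ numCycles (w , t) l c
    same-count zero    c = refl
    same-count (suc l) c = cong (_/ suc l) (countB-cong
      (λ i → cong (λ col → (cycleLen w i ≡ᵇ suc l) ∧ (col ≡ᵇ toℕ c)) (same-colours i)) (allFin n))

  module Orbit {n : ℕ} (w : Vec (Fin n) n) (w-inj : Injective _≡_ _≡_ (lookup w)) where

    iter-+ : ∀ p s i → iter w (p + s) i ≡ iter w p (iter w s i)
    iter-+ zero    s i = refl
    iter-+ (suc p) s i = cong (lookup w) (iter-+ p s i)

    iter-injective : ∀ p → Injective _≡_ _≡_ (iter w p)
    iter-injective zero    eq = eq
    iter-injective (suc p) eq = iter-injective p (w-inj eq)

    iter-comm : ∀ p s i → iter w p (iter w s i) ≡ iter w s (iter w p i)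
    iter-comm p s i = begin
      iter w p (iter w s i) ≡⟨ iter-+ p s i ⟨
      iter w (p + s) i      ≡⟨ cong (λ m → iter w m i) (+-comm p s) ⟩
      iter w (s + p) i      ≡⟨ iter-+ s p i ⟩
      iter w s (iter w p i) ∎

    period : ∀ i → ∃ λ p → 0 < p × p ≤ n × iter w p i ≡ i
    period i with pigeonhole (n<1+n n) (λ k → iter w (toℕ k) i)
    ... | k₁ , k₂ , k₁<k₂ , same =
      d , m<n⇒0<n∸m k₁<k₂ , ≤-trans (m∸n≤m (toℕ k₂) (toℕ k₁)) (s≤s⁻¹ (toℕ<n k₂)) ,
      iter-injective (toℕ k₁) (begin
        iter w (toℕ k₁) (iter w d i) ≡⟨ iter-+ (toℕ k₁) d i ⟨
        iter w (toℕ k₁ + d) i        ≡⟨ cong (λ m → iter w m i) (m+[n∸m]≡n (<⇒≤ k₁<k₂)) ⟩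
        iter w (toℕ k₂) i            ≡⟨ same ⟨
        iter w (toℕ k₁) i            ∎)
      where d = toℕ k₂ ∸ toℕ k₁

    cycleLen-spec : ∀ i → ∃ λ j → cycleLen w i ≡ suc j × j < n × iter w (suc j) i ≡ i ×
                                  (∀ m → m < j → iter w (suc m) i ≢ i)
    cycleLen-spec i with period i
    ... | suc p , _ , p<n , returns with firstIn-least n suc (λ m → iter w m i ==F i) p p<n
                                   (trans (cong (_==F i) returns) (==F-refl i))
    ...   | j , j≤p , found , back , before =
            j , trans (cong (λ ms → firstIn ms (λ m → iter w m i ==F i)) (map-upTo suc n)) found , ≤-<-trans j≤p p<n ,
            ==F⇒≡ back , λ m m<j returned → contradiction (trans (sym (before m m<j))
                                             (trans (cong (_==F i) returned) (==F-refl i))) λ ()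

    0<cycleLen : ∀ i → 0 < cycleLen w i
    0<cycleLen i with cycleLen-spec i
    ... | j , len≡ , _ = subst (0 <_) (sym len≡) z<s

    iter-cycleLen : ∀ i → iter w (cycleLen w i) i ≡ i
    iter-cycleLen i with cycleLen-spec i
    ... | j , len≡ , _ , back , _ = trans (cong (λ m → iter w m i) len≡) back

    iter-≢ : ∀ i {m} → 0 < m → m < cycleLen w i → iter w m i ≢ i
    iter-≢ i {suc m} _ m<L with cycleLen-spec i
    ... | j , len≡ , _ , _ , before = before m (s≤s⁻¹ (subst (suc m <_) len≡ m<L))

    cycleLen-minimal : ∀ i {m} → 0 < m → iter w m i ≡ i → cycleLen w i ≤ m
    cycleLen-minimal i 0<m back = ≮⇒≥ λ m<L → iter-≢ i 0<m m<L back

    iter-periodic : ∀ i h → iter w (h + cycleLen w i) i ≡ iter w h i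
    iter-periodic i h = trans (iter-+ h (cycleLen w i) i) (cong (iter w h) (iter-cycleLen i))

    iter-apart : ∀ i {a b} → a < b → b < cycleLen w i → iter w a i ≢ iter w b i
    iter-apart i {a} {b} a<b b<L eq = iter-≢ i (m<n⇒0<n∸m a<b) (≤-<-trans (m∸n≤m b a) b<L) (iter-injective a (begin
      iter w a (iter w (b ∸ a) i) ≡⟨ iter-+ a (b ∸ a) i ⟨
      iter w (a + (b ∸ a)) i      ≡⟨ cong (λ m → iter w m i) (m+[n∸m]≡n (<⇒≤ a<b)) ⟩
      iter w b i                  ≡⟨ eq ⟨
      iter w a i                  ∎))

    iter-injectiveOn : ∀ i {h₁ h₂} → h₁ < cycleLen w i → h₂ < cycleLen w i →
                       iter w h₁ i ≡ iter w h₂ i → h₁ ≡ h₂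
    iter-injectiveOn i {h₁} {h₂} h₁<L h₂<L eq with <-cmp h₁ h₂
    ... | tri< h₁<h₂ _ _ = contradiction eq (iter-apart i h₁<h₂ h₂<L)
    ... | tri≈ _ h₁≡h₂ _ = h₁≡h₂
    ... | tri> _ _ h₂<h₁ = contradiction (sym eq) (iter-apart i h₂<h₁ h₁<L)

    cycleLen-iter : ∀ s i → cycleLen w (iter w s i) ≡ cycleLen w i
    cycleLen-iter s i = ≤-antisym
      (cycleLen-minimal (iter w s i) (0<cycleLen i) (begin
        iter w (cycleLen w i) (iter w s i) ≡⟨ iter-comm (cycleLen w i) s i ⟩
        iter w s (iter w (cycleLen w i) i) ≡⟨ cong (iter w s) (iter-cycleLen i) ⟩
        iter w s i                          ∎))
      (cycleLen-minimal i (0<cycleLen (iter w s i)) (iter-injective s (begin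
        iter w s (iter w (cycleLen w (iter w s i)) i) ≡⟨ iter-comm s (cycleLen w (iter w s i)) i ⟩
        iter w (cycleLen w (iter w s i)) (iter w s i) ≡⟨ iter-cycleLen (iter w s i) ⟩
        iter w s i                                     ∎)))

    module _ {r : ℕ} .{{_ : NonZero r}} (t : Vec (Fin r) n) where

      cycleCol-iter : ∀ s i → cycleCol (w , t) (iter w s i) ≡ cycleCol (w , t) i
      cycleCol-iter s i = begin
        cycleCol (w , t) (iter w s i)
          ≡⟨ cycleCol-∑ w t (iter w s i) ⟩
        (∑[ h < cycleLen w (iter w s i) ] colour (iter w h (iter w s i))) % r
          ≡⟨ cong (λ L → ∑[ h < L ] colour (iter w h (iter w s i)) % r) (cycleLen-iter s i) ⟩
        (∑[ h < cycleLen w i ] colour (iter w h (iter w s i))) % r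
          ≡⟨ cong (_% r) (∑-cong (cycleLen w i) (λ h _ → cong colour (iter-+ h s i))) ⟨
        (∑[ h < cycleLen w i ] colour (iter w (h + s) i)) % r
          ≡⟨ cong (_% r) (∑-rotate (cycleLen w i) (λ h → colour (iter w h i)) (λ h → cong colour (iter-periodic i h)) s) ⟩
        (∑[ h < cycleLen w i ] colour (iter w h i)) % r
          ≡⟨ cycleCol-∑ w t i ⟨
        cycleCol (w , t) i ∎
        where
        colour : Fin n → ℕ
        colour y = toℕ (lookup t y)

      -- Along every cycle, the offsets +1 at x and -1 at wᵐ x occur equally often.
      cycleCol-plusMinus : ∀ x m i → cycleCol (w , shift (plusMinus r x (iter w m x)) t) i ≡ cycleCol (w , t) i
      cycleCol-plusMinus x m i = begin
        cycleCol (w , shift D t) i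
          ≡⟨ cycleCol-∑ w (shift D t) i ⟩
        (∑[ h < L ] toℕ (lookup (shift D t) (y h))) % r
          ≡⟨ cong (_% r) (∑-cong L (λ h _ → toℕ-lookup-shift D t (y h))) ⟩
        (∑[ h < L ] ((T h + D (y h)) % r)) % r
          ≡⟨ ∑-% L (λ h → T h + D (y h)) r ⟩
        (∑[ h < L ] (T h + D (y h))) % r
          ≡⟨ cong (_% r) (∑-+ L T (D ∘ y)) ⟩
        (∑< L T + ∑< L (D ∘ y)) % r
          ≡⟨ cong (λ z → (∑< L T + z) % r) offsets ⟩
        (∑< L T + hits * r) % r
          ≡⟨ [m+kn]%n≡m%n (∑< L T) hits r ⟩
        ∑< L T % r
          ≡⟨ cycleCol-∑ w t i ⟨
        cycleCol (w , t) i ∎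
        where
        D = plusMinus r x (iter w m x)
        L = cycleLen w i
        y : ℕ → Fin n
        y h = iter w h i
        T : ℕ → ℕ
        T h = toℕ (lookup t (y h))
        hits : ℕ
        hits = ∑[ h < L ] indicator (y h ==F x)
        hits-at-wᵐx : ∑[ h < L ] indicator (y h ==F iter w m x) ≡ hits
        hits-at-wᵐx = begin
          ∑[ h < L ] indicator (y h ==F iter w m x)
            ≡⟨ ∑-rotate L (λ h → indicator (y h ==F iter w m x))
                          (λ h → cong (λ z → indicator (z ==F iter w m x)) (iter-periodic i h)) m ⟨
          ∑[ h < L ] indicator (y (h + m) ==F iter w m x)
            ≡⟨ ∑-cong L (λ h _ → cong indicator (begin
                 (y (h + m) ==F iter w m x)       ≡⟨ cong (_==F iter w m x) (trans (iter-+ h m i) (iter-comm h m i)) ⟩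
                 (iter w m (y h) ==F iter w m x)  ≡⟨ ==F-injective (iter-injective m) (y h) x ⟩
                 (y h ==F x)                      ∎)) ⟩
          hits ∎
        offsets : ∑< L (D ∘ y) ≡ hits * r
        offsets = begin
          ∑< L (D ∘ y)
            ≡⟨ ∑-+ L (λ h → indicator (y h ==F x)) (λ h → pred r * indicator (y h ==F iter w m x)) ⟩
          hits + ∑[ h < L ] (pred r * indicator (y h ==F iter w m x))
            ≡⟨ cong (hits +_) (trans (∑-* L (pred r) _) (cong (pred r *_) hits-at-wᵐx)) ⟩
          suc (pred r) * hits
            ≡⟨ cong (_* hits) (suc-pred r) ⟩
          r * hits
            ≡⟨ *-comm r hits ⟩
          hits * r ∎

      cycle-counted : ∀ i (c : Fin r) → toℕ c ≡ cycleCol (w , t) i → ∀ {l} → cycleLen w i ≡ suc l →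
                      0 < numCycles (w , t) (suc l) c
      cycle-counted i c c≡col {l} len≡ = m≥n⇒m/n>0 (injective⇒≤length (λ h → iter w (toℕ h) i) on-cycle-injective
        λ h → ∈-filterB on-such-cycle (∈-allFin _) (lies-on-such-cycle h))
        where
        on-such-cycle : Fin n → Bool
        on-such-cycle i′ = (cycleLen w i′ ≡ᵇ suc l) ∧ (cycleCol (w , t) i′ ≡ᵇ toℕ c)
        bound : (h : Fin (suc l)) → toℕ h < cycleLen w i
        bound h = subst (toℕ h <_) (sym len≡) (toℕ<n h)
        on-cycle-injective : Injective _≡_ _≡_ (λ (h : Fin (suc l)) → iter w (toℕ h) i)
        on-cycle-injective {h₁} {h₂} eq = toℕ-injective (iter-injectiveOn i (bound h₁) (bound h₂) eq)
        lies-on-such-cycle : ∀ h → on-such-cycle (iter w (toℕ h) i) ≡ true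
        lies-on-such-cycle h = cong₂ _∧_
          (trans (cong (_≡ᵇ suc l) (trans (cycleLen-iter (toℕ h) i) len≡)) (≡ᵇ-refl (suc l)))
          (trans (cong₂ _≡ᵇ_ (cycleCol-iter (toℕ h) i) c≡col) (≡ᵇ-refl (cycleCol (w , t) i)))

      sameType⇒long-cycles : ∀ {K} (g₀ : Elt n r) → (∀ l c → 1 ≤ l → l ≤ K → numCycles g₀ l c ≡ 0) →
                             sameType (w , t) g₀ ≡ true → ∀ i → K < cycleLen w i
      sameType⇒long-cycles g₀ no-short-cycles same i with cycleLen-spec i
      ... | l , len≡ , l<n , _ = ≰⇒> λ L≤K → <-irrefl
        (sym (trans (sameType⇒numCycles≡ same c l<n) (no-short-cycles (suc l) c (s≤s z≤n) (subst (_≤ _) len≡ L≤K))))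
        (cycle-counted i c (toℕ-fromℕ< (cycleCol<r (w , t) i)) len≡)
        where c = fromℕ< (cycleCol<r (w , t) i)

    off-list-iterate : (xs : List ℕ) (i : Fin n) → suc (length xs) < cycleLen w i →
                       ∃ λ m → 0 < m × m < cycleLen w i × suc (toℕ (iter w m i)) ∉ xs
    off-list-iterate xs i long with any? {suc (length xs)} (λ h → ¬? (suc (toℕ (iter w (suc (toℕ h)) i)) ∈? xs))
    ... | yes (h , off) = suc (toℕ h) , z<s , <-≤-trans (s<s (toℕ<n h)) long , off
    ... | no all-on = contradiction (injective⇒≤length position position-injective on-list) (<-irrefl refl)
      where
      position : Fin (suc (length xs)) → ℕ
      position h = suc (toℕ (iter w (suc (toℕ h)) i))
      on-list : ∀ h → position h ∈ xs
      on-list h = decidable-stable (position h ∈? xs) λ off → all-on (h , off)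
      bound : (h : Fin (suc (length xs))) → suc (toℕ h) < cycleLen w i
      bound h = <-≤-trans (s<s (toℕ<n h)) long
      position-injective : Injective _≡_ _≡_ position
      position-injective {h₁} {h₂} eq = toℕ-injective (suc-injective
        (iter-injectiveOn i (bound h₁) (bound h₂) (toℕ-injective (suc-injective eq))))

  -- The group and the conjugacy classes

  countB-Y-fibre : ∀ {n r} .{{_ : NonZero r}} (w : Vec (Fin n) n) (Q : Vec (Fin r) n → Bool) (x : Fin n)
                   (D : Fin n → ℕ) → D x ≡ 1 → (∀ t → Q (shift D t) ≡ Q t) → (c : Fin r) →
                   r * countB (λ t → Q t ∧ Y (suc (toℕ x)) c (w , t)) (allVecs r n) ≡ countB Q (allVecs r n)
  countB-Y-fibre {n} {r} w Q x D D[x]≡1 Q-shift c = trans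
    (cong (r *_) (countB-cong (λ t → cong (λ col → Q t ∧ (col ≡ᵇ toℕ c)) (colAt-index w t x)) (allVecs r n)))
    (countB-fibre Q x D D[x]≡1 Q-shift c)

  countB-group : ∀ n r (f : Elt n r → Bool) →
                 countB f (group n r) ≡ sum (map (λ w → countB (λ t → f (w , t)) (allVecs r n)) (filterB isPerm (allVecs n n)))
  countB-group n r f = trans (countB-concatMap f _ (filterB isPerm (allVecs n n)))
                             (cong sum (map-cong (λ w → countB-map f (w ,_) (allVecs r n)) (filterB isPerm (allVecs n n))))

  *-countB-group : ∀ n r (f g : Elt n r → Bool) →
                   (∀ w → isPerm w ≡ true →
                      r * countB (λ t → f (w , t)) (allVecs r n) ≡ countB (λ t → g (w , t)) (allVecs r n)) →
                   r * countB f (group n r) ≡ countB g (group n r)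
  *-countB-group n r f g per-perm = trans (cong (r *_) (countB-group n r f))
    (trans (*-sum-filterB isPerm r per-perm (allVecs n n)) (sym (countB-group n r g)))

  module _ {n r j q : ℕ} .{{_ : NonZero r}} (bs : Vec ℕ j) (ds : Vec (ℕ × Fin r) q)
           (1≤bs : All (1 ≤_) bs) (1≤ds : All ((1 ≤_) ∘ proj₁) ds)
           (x : Fin n) (x∉Ess : ¬ InEss (suc (toℕ x)) bs ds) (c : Fin r) where

    private
      P : Elt n r → Bool
      P = prodXY bs ds

      Y-at-x : Elt n r → Bool
      Y-at-x = Y (suc (toℕ x)) c

    *-countB-Y-group : r * countB (P ⊗ Y-at-x) (group n r) ≡ countB P (group n r)
    *-countB-Y-group = *-countB-group n r (P ⊗ Y-at-x) P λ w _ →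
      countB-Y-fibre w (λ t → P (w , t)) x D (cong indicator (==F-refl x))
                     (λ t → prodXY-shift bs ds 1≤bs 1≤ds D off-Ess w t) c
      where
      D : Fin n → ℕ
      D z = indicator (z ==F x)
      off-Ess : ∀ i → InEss (suc (toℕ i)) bs ds → D i ≡ 0
      off-Ess i i∈Ess = cong indicator (==F-≢ λ { refl → x∉Ess i∈Ess })

    module _ (g₀ : Elt n r) (no-short-cycles : ∀ l c′ → 1 ≤ l → l ≤ j + (j + q + 1) → numCycles g₀ l c′ ≡ 0) where

      private
        S : Elt n r → Bool
        S g = sameType g g₀

      module _ (w : Vec (Fin n) n) (w-inj : Injective _≡_ _≡_ (lookup w)) where
        open Orbit w w-inj

        private
          Q : Vec (Fin r) n → Bool
          Q t = S (w , t) ∧ P (w , t)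

        short-cycle⇒outside-class : ¬ (j + (j + q + 1) < cycleLen w x) → ∀ t → S (w , t) ≡ false
        short-cycle⇒outside-class short t with S (w , t) in same
        ... | true  = contradiction (sameType⇒long-cycles t g₀ no-short-cycles same x) short
        ... | false = refl

        *-countB-Y-long-cycle : j + (j + q + 1) < cycleLen w x →
                                r * countB (λ t → Q t ∧ Y-at-x (w , t)) (allVecs r n) ≡ countB Q (allVecs r n)
        *-countB-Y-long-cycle long
          with m , 0<m , m<L , y∉Ess ← off-list-iterate (essList bs ds) x (≤-<-trans (length-essList bs ds) long) =
          countB-Y-fibre w Q x D (plusMinus-source r λ x≡y → iter-≢ x 0<m m<L (sym x≡y)) Q-shift c
          where
          D = plusMinus r x (iter w m x)
          off-Ess : ∀ i → InEss (suc (toℕ i)) bs ds → D i ≡ 0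
          off-Ess i i∈Ess = plusMinus-elsewhere r (λ { refl → x∉Ess i∈Ess })
                                                  (λ { refl → y∉Ess (InEss⇒∈essList bs ds i∈Ess) })
          Q-shift : ∀ t → Q (shift D t) ≡ Q t
          Q-shift t = cong₂ _∧_ (sameType-cong w g₀ (cycleCol-plusMinus t x m))
                                (prodXY-shift bs ds 1≤bs 1≤ds D off-Ess w t)

        *-countB-Y-class-perm : r * countB (λ t → Q t ∧ Y-at-x (w , t)) (allVecs r n) ≡ countB Q (allVecs r n)
        *-countB-Y-class-perm with j + (j + q + 1) <? cycleLen w x
        ... | yes long  = *-countB-Y-long-cycle long
        ... | no  short = begin
          r * countB (λ t → Q t ∧ Y-at-x (w , t)) (allVecs r n) ≡⟨ cong (r *_) (countB-none _ (λ t →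
                                                                      cong (λ b → (b ∧ P (w , t)) ∧ Y-at-x (w , t)) (outside t)) (allVecs r n)) ⟩
          r * 0                                                  ≡⟨ *-zeroʳ r ⟩
          0                                                      ≡⟨ countB-none Q (λ t → cong (_∧ P (w , t)) (outside t)) (allVecs r n) ⟨
          countB Q (allVecs r n)                                 ∎
          where outside = short-cycle⇒outside-class short

      *-countB-Y-class : r * countB (P ⊗ Y-at-x) (classOf g₀) ≡ countB P (classOf g₀)
      *-countB-Y-class = begin
        r * countB (P ⊗ Y-at-x) (classOf g₀)
          ≡⟨ cong (r *_) (countB-filterB (P ⊗ Y-at-x) S (group n r)) ⟩
        r * countB (λ g → S g ∧ (P g ∧ Y-at-x g)) (group n r)
          ≡⟨ cong (r *_) (countB-cong (λ g → sym (∧-assoc (S g) (P g) (Y-at-x g))) (group n r)) ⟩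
        r * countB ((S ⊗ P) ⊗ Y-at-x) (group n r)
          ≡⟨ *-countB-group n r _ _ (λ w perm → *-countB-Y-class-perm w (isPerm⇒injective w perm)) ⟩
        countB (S ⊗ P) (group n r)
          ≡⟨ countB-filterB P S (group n r) ⟨
        countB P (classOf g₀) ∎


open Counting
open import Data.Fin using (fromℕ<)
open import Data.Fin.Properties using (toℕ-fromℕ<)
open import Data.List using (length)
open import Data.Nat as N using (zero; suc)
open import Data.Nat.Properties using (*-assoc; *-comm)
import Data.Vec.Relation.Unary.All as Allᵥ
import Data.Integer as ℤ
import Data.Integer.Properties as ℤ
import Data.Rational.Properties as ℚ
import Data.Rational.Unnormalised as ℚᵘ
import Data.Rational.Unnormalised.Properties as ℚᵘ
open import Relation.Binary.PropositionalEquality using (refl; sym; trans; cong; module ≡-Reasoning)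

open import Data.Nat using (ℕ; _+_; _∸_; _≤_; NonZero)
open import Data.Fin using (Fin)
open import Data.Bool using (true)
open import Data.Integer using (+_)
open import Data.Rational using (ℚ; _/_; _*_)
open import Data.Vec using (Vec)
open import Data.Vec.Relation.Unary.All using (All)
open import Data.Product using (_×_; _,_; proj₁)
open import Relation.Nullary using (¬_)
open import Relation.Binary.PropositionalEquality using (_≡_)

open ≡-Reasoning

ratio-scale : ∀ r .{{_ : NonZero r}} x y len → r N.* x ≡ y → ratio x len ≡ ((+ 1) / r) * ratio y len
ratio-scale r       x y zero    _    = sym (ℚ.*-zeroʳ ((+ 1) / r))
ratio-scale (suc k) x _ (suc l) refl = ℚ.toℚᵘ-injective
  (ℚᵘ.≃-trans (ℚ.toℚᵘ-fromℚᵘ (ℚᵘ.mkℚᵘ (+ x) l)) (ℚᵘ.≃-trans scale (ℚᵘ.≃-sym (ℚᵘ.≃-trans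
    (ℚ.toℚᵘ-homo-* ((+ 1) / suc k) ((+ (suc k N.* x)) / suc l))
    (ℚᵘ.*-cong (ℚ.toℚᵘ-fromℚᵘ (ℚᵘ.mkℚᵘ (+ 1) k)) (ℚ.toℚᵘ-fromℚᵘ (ℚᵘ.mkℚᵘ (+ (suc k N.* x)) l)))))))
  where
  scale : ℚᵘ.mkℚᵘ (+ x) l ℚᵘ.≃ ℚᵘ.mkℚᵘ (+ 1) k ℚᵘ.* ℚᵘ.mkℚᵘ (+ (suc k N.* x)) l
  scale = ℚᵘ.*≡* (begin
    + x ℤ.* + (suc k N.* suc l)             ≡⟨ ℤ.pos-* x _ ⟨
    + (x N.* (suc k N.* suc l))             ≡⟨ cong +_ (trans (sym (*-assoc x (suc k) (suc l)))
                                                              (cong (N._* suc l) (*-comm x (suc k)))) ⟩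
    + (suc k N.* x N.* suc l)               ≡⟨ ℤ.pos-* (suc k N.* x) (suc l) ⟩
    + (suc k N.* x) ℤ.* + suc l             ≡⟨ cong (ℤ._* + suc l) (ℤ.*-identityˡ (+ (suc k N.* x))) ⟨
    (+ 1 ℤ.* + (suc k N.* x)) ℤ.* + suc l   ∎)

lemma4p3 : (n r : ℕ) .{{_ : NonZero r}} (j q : ℕ)
    (bs : Vec ℕ j) (ds : Vec (ℕ × Fin r) q) (a : ℕ) (c : Fin r) →
    All (λ b → 1 ≤ b × b ≤ n ∸ 1) bs →
    All (λ d → 1 ≤ proj₁ d × proj₁ d ≤ n) ds →
    1 ≤ a → a ≤ n →
    ¬ InEss a bs ds →
    (E (group n r) (prodXY bs ds ⊗ Y a c)
       ≡ ((+ 1) / r) * E (group n r) (prodXY bs ds))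
    × ((g₀ : Elt n r) → isPerm (proj₁ g₀) ≡ true →
         ((l : ℕ) (c′ : Fin r) → 1 ≤ l → l ≤ j + (j + q + 1) → numCycles g₀ l c′ ≡ 0) →
         E (classOf g₀) (prodXY bs ds ⊗ Y a c)
           ≡ ((+ 1) / r) * E (classOf g₀) (prodXY bs ds))
lemma4p3 n r j q bs ds (suc k) c bs-in-range ds-in-range _ k<n a∉Ess with fromℕ< k<n | toℕ-fromℕ< k<n
... | x | refl =
  ratio-scale r _ _ (length (group n r)) (*-countB-Y-group bs ds 1≤bs 1≤ds x a∉Ess c) ,
  λ g₀ _ no-short-cycles → ratio-scale r _ _ (length (classOf g₀))
                             (*-countB-Y-class bs ds 1≤bs 1≤ds x a∉Ess c g₀ no-short-cycles)
  where
  1≤bs = Allᵥ.map proj₁ bs-in-range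
  1≤ds = Allᵥ.map proj₁ ds-in-range
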